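{- Let $a,b,c$ be positive integers and let $(x_n)_{n\in\mathbb{Z}}$ satisfy $x_n=ax_{n-1}+bx_{n-2}+cx_{n-3}$ for all $n\in\mathbb{Z}$, with $x_0,x_1,x_2\in\mathbb{Z}$. Suppose that the characteristic polynomial $x^3-ax^2-bx-c$ has a real root $\gamma>1$ and that $$\gamma^{ -1}\le x_1\le\gamma^0\le x_2\le\gamma^1\le x_3\le\gamma^2.$$ If there exists a prime $p$ for which the Marques–Lengyel conjecture holds for $(x_n)$, then the equation $x_n=m!$ has only finitely many solutions in positive integers $(n,m)$.
   Context: For a nonzero rational $r$, $\nu_p(r)$ is the exponent of $p$ in $r$, and $\nu_p(0)=\infty$. The Marques–Lengyel conjecture holds for $(x_n)_{n\in\mathbb{Z}}$ and a prime $p$ if there is a positive integer $Q$ such that for every $i\in\{0,1,\dots,Q-1\}$ one of the following holds: (C) there is $\kappa_i\in\mathbb{Z}_{\ge0}$ such that $\nu_p(x_n)=\kappa_i$ for all but finitely many $n\in\mathbb{Z}$ with $n\equiv i\pmod Q$; or (L) there exist $a_i\in\mathbb{Z}$, $\kappa_i\in\mathbb{Z}$, $\mu_i\in\mathbb{Z}_{>0}$ with $\nu_p(a_i-i)\ge\nu_p(Q)$ such that $\nu_p(x_n)=\kappa_i+\mu_i\nu_p(n-a_i)$ for all but finitely many $n\in\mathbb{Z}$ with $n\equiv i\pmod Q$. -}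

module Defs where

open import Data.Nat as ℕ using (ℕ; zero; suc)
open import Data.Nat.Divisibility as ℕD using ()
open import Data.Integer as ℤ using (ℤ; +_; -[1+_])
open import Data.Integer.Divisibility as ℤD using ()
open import Data.Rational as ℚ using (ℚ; ↥_; ↧ₙ_; _/_; 0ℚ; 1ℚ)
open import Data.Product using (Σ; ∃; ∃-syntax; _×_)
open import Data.Sum using (_⊎_)
open import Relation.Nullary using (¬_)
open import Relation.Binary.PropositionalEquality using (_≡_)

ℤ→ℚ : ℤ → ℚ
ℤ→ℚ z = z / 1

ℕ→ℚ : ℕ → ℚ
ℕ→ℚ n = (+ n) / 1

data ℤ∞ : Set where
  fin : ℤ → ℤ∞
  ∞   : ℤ∞

data _≤∞_ : ℤ∞ → ℤ∞ → Set where
  fin≤fin : ∀ {k l} → k ℤ.≤ l → fin k ≤∞ fin l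
  _≤∞∞    : ∀ u → u ≤∞ ∞

-- κ + μ·v   (μ > 0, so κ + μ·∞ = ∞)
affine : ℤ → ℕ → ℤ∞ → ℤ∞
affine κ μ (fin k) = fin (κ ℤ.+ (+ μ) ℤ.* k)
affine κ μ ∞       = ∞

-- ValFin p r k : "r ≠ 0 and ν_p(r) = k".  ℚ values are stored in lowest
-- terms (numerator ↥ r, denominator ↧ₙ r coprime), so ν_p(r) is the
-- exponent of p in the numerator minus the exponent of p in the denominator.
ValFin : ℕ → ℚ → ℤ → Set
ValFin p r (+ k) =
  (∃[ m ] (ℤ.∣ ↥ r ∣ ≡ p ℕ.^ k ℕ.* m × ¬ (p ℕD.∣ m))) × ¬ (p ℕD.∣ ↧ₙ r)
ValFin p r -[1+ k ] =
  ¬ (p ℕD.∣ ℤ.∣ ↥ r ∣) × (∃[ d ] (↧ₙ r ≡ p ℕ.^ (suc k) ℕ.* d × ¬ (p ℕD.∣ d)))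

HasVal : ℕ → ℚ → ℤ∞ → Set
HasVal p r (fin k) = ValFin p r k
HasVal p r ∞       = r ≡ 0ℚ

HasValℤ : ℕ → ℤ → ℤ∞ → Set
HasValℤ p z v = HasVal p (ℤ→ℚ z) v

CofinitelyInClass : ℕ → ℕ → (ℤ → Set) → Set
CofinitelyInClass Q i P =
  ∃[ N ] (∀ (n : ℤ) → (+ Q) ℤD.∣ (n ℤ.- + i) → N ℕ.≤ ℤ.∣ n ∣ → P n)

CaseC : ℕ → (ℤ → ℚ) → ℕ → ℕ → Set
CaseC p x Q i = ∃[ κ ] CofinitelyInClass Q i (λ n → HasVal p (x n) (fin (+ κ)))

CaseL : ℕ → (ℤ → ℚ) → ℕ → ℕ → Set
CaseL p x Q i =
  ∃[ a ] ∃[ κ ] ∃[ μ ]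
    ( 0 ℕ.< μ
    × (∃[ u ] ∃[ w ] (HasValℤ p (+ Q) u × HasValℤ p (a ℤ.- + i) w × u ≤∞ w))
    × CofinitelyInClass Q i
        (λ n → ∃[ v ] (HasValℤ p (n ℤ.- a) v × HasVal p (x n) (affine κ μ v))))

MarquesLengyel : (ℤ → ℚ) → ℕ → Set
MarquesLengyel x p =
  ∃[ Q ] (0 ℕ.< Q × (∀ i → i ℕ.< Q → CaseC p x Q i ⊎ CaseL p x Q i))

-- No real numbers are available, so γ is represented as the infimum of
-- the set of rationals  U = { q > 0 : q³ - a q² - b q - c ≥ 0 }
-- (for a, b, c > 0 the polynomial has exactly one positive root γ, it is
-- > 1, and U = ℚ ∩ [γ, ∞)).  Comparisons with γ, γ⁻¹, γ² are expressed
-- through this infimum.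

charPoly : ℕ → ℕ → ℕ → ℚ → ℚ
charPoly a b c q =
  q ℚ.* q ℚ.* q ℚ.- ℕ→ℚ a ℚ.* q ℚ.* q ℚ.- ℕ→ℚ b ℚ.* q ℚ.- ℕ→ℚ c

InU : ℕ → ℕ → ℕ → ℚ → Set
InU a b c q = 0ℚ ℚ.< q × 0ℚ ℚ.≤ charPoly a b c q

_≤γ[_,_,_] : ℚ → ℕ → ℕ → ℕ → Set
r ≤γ[ a , b , c ] = ∀ q → InU a b c q → r ℚ.≤ q

γ[_,_,_]≤_ : ℕ → ℕ → ℕ → ℚ → Set
γ[ a , b , c ]≤ r = ∀ s → r ℚ.< s → ∃[ q ] (InU a b c q × q ℚ.≤ s)

-- γ⁻¹ ≤ r   (γ⁻¹ = sup { 1/q : q ∈ U })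
γ⁻¹[_,_,_]≤_ : ℕ → ℕ → ℕ → ℚ → Set
γ⁻¹[ a , b , c ]≤ r = ∀ q → InU a b c q → 1ℚ ℚ.≤ q ℚ.* r

-- r ≤ γ²   (γ² = inf { q² : q ∈ U })
_≤γ²[_,_,_] : ℚ → ℕ → ℕ → ℕ → Set
r ≤γ²[ a , b , c ] = ∀ q → InU a b c q → r ℚ.≤ q ℚ.* q

{-# OPTIONS --safe #-}
module Submission where

-- The bounds on x₁, x₂, x₃ are only used to see that x₁, x₂ ≥ 0 and x₃ ≥ 1 (every element of the
-- set U defining γ exceeds 1). With positive coefficients the
-- sequence is then a natural-number sequence from index 1 on with x_{n+2} ≥ 2x_n for n ≥ 3, so
-- x_n = m! ≤ 2^(m²) forces n ≤ 2m² + 4, and it suffices to bound m. Up to finitely many n, this is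
-- done in each residue class i mod Q separately. In case (C), ν_p(m!) = κ forces m < (κ + 1)p.
-- In case (L), put j = ν_p(n - a): ν_p(m!) = κ + μj makes m at most linear in j, while
-- p^j ≤ |n - a| is at most quadratic in m; hence 2^j ≤ C(j + 1)², which bounds j and then m.

module Arithmetic where

  open import Data.Nat
  open import Data.Nat.Properties
  open import Data.Nat.DivMod using (_/_; _%_; m≡m%n+[m/n]*n; m%n<n)
  open import Data.Nat.Divisibility
    using (_∣_; 1∣_; n∣m*n; ∣-trans; *-pres-∣; *-cancelˡ-∣; m≤n⇒m!∣n!)
  open import Data.Nat.Tactic.RingSolver using (solve-∀)
  open import Relation.Nullary using (¬_)
  open import Relation.Binary.PropositionalEquality using (_≡_; sym; cong; subst; subst₂)

  n<2^n : ∀ n → n < 2 ^ n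
  n<2^n zero    = z<s
  n<2^n (suc n) = begin-strict
    suc n         ≤⟨ n<2^n n ⟩
    2 ^ n         <⟨ m<m+n (2 ^ n) (m^n>0 2 n) ⟩
    2 ^ n + 2 ^ n ≡⟨ cong (2 ^ n +_) (+-identityʳ (2 ^ n)) ⟨
    2 ^ suc n     ∎
    where open ≤-Reasoning

  -- Write n = r + 3k with r < 3; then (k + 1)³ ≤ 2^(3k) ≤ 2^n ≤ c(n + 1)² ≤ 9c(k + 1)².
  2^n≤c*[1+n]²⇒n<27*c : ∀ c n → 2 ^ n ≤ c * (suc n * suc n) → n < 27 * c
  2^n≤c*[1+n]²⇒n<27*c c n 2^n≤c[1+n]² = begin-strict
    n           ≡⟨ n≡r+k*3 ⟩
    r + k * 3   <⟨ +-monoˡ-< (k * 3) (m%n<n n 3) ⟩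
    suc k * 3   ≡⟨ *-comm (suc k) 3 ⟩
    3 * suc k   ≤⟨ *-monoʳ-≤ 3 1+k≤9*c ⟩
    3 * (9 * c) ≡⟨ *-assoc 3 9 c ⟨
    27 * c      ∎
    where
    open ≤-Reasoning
    k r : ℕ
    k = n / 3
    r = n % 3
    n≡r+k*3 : n ≡ r + k * 3
    n≡r+k*3 = m≡m%n+[m/n]*n n 3
    1+n≤3+k*3 : suc n ≤ 3 + k * 3
    1+n≤3+k*3 = subst (λ t → suc t ≤ 3 + k * 3) (sym n≡r+k*3) (+-monoˡ-≤ (k * 3) (m%n<n n 3))
    c*[3+k*3]²≡9*c*[1+k]² : ∀ c k → c * ((3 + k * 3) * (3 + k * 3)) ≡ 9 * c * ((1 + k) * (1 + k))
    c*[3+k*3]²≡9*c*[1+k]² = solve-∀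
    1+k≤9*c : suc k ≤ 9 * c
    1+k≤9*c = *-cancelʳ-≤ (suc k) (9 * c) (suc k * suc k) (begin
      suc k * (suc k * suc k)         ≤⟨ *-mono-≤ (n<2^n k) (*-mono-≤ (n<2^n k) (n<2^n k)) ⟩
      2 ^ k * (2 ^ k * 2 ^ k)         ≡⟨ cong (λ t → 2 ^ k * (2 ^ k * t)) (*-identityʳ (2 ^ k)) ⟨
      (2 ^ k) ^ 3                     ≡⟨ ^-*-assoc 2 k 3 ⟩
      2 ^ (k * 3)                     ≤⟨ ^-monoʳ-≤ 2 (m≤n+m (k * 3) r) ⟩
      2 ^ (r + k * 3)                 ≡⟨ cong (2 ^_) n≡r+k*3 ⟨
      2 ^ n                           ≤⟨ 2^n≤c[1+n]² ⟩
      c * (suc n * suc n)             ≤⟨ *-monoʳ-≤ c (*-mono-≤ 1+n≤3+k*3 1+n≤3+k*3) ⟩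
      c * ((3 + k * 3) * (3 + k * 3)) ≡⟨ c*[3+k*3]²≡9*c*[1+k]² c k ⟩
      9 * c * (suc k * suc k)         ∎)

  2^m≤2^n⇒m≤n : ∀ {m n} → 2 ^ m ≤ 2 ^ n → m ≤ n
  2^m≤2^n⇒m≤n 2^m≤2^n = ≮⇒≥ λ n<m → <⇒≱ (^-monoʳ-< 2 (s≤s (s≤s z≤n)) n<m) 2^m≤2^n

  k≤1+2*⌊k/2⌋ : ∀ k → k ≤ suc (2 * ⌊ k /2⌋)
  k≤1+2*⌊k/2⌋ 0             = z≤n
  k≤1+2*⌊k/2⌋ 1             = s≤s z≤n
  k≤1+2*⌊k/2⌋ (suc (suc k)) = begin
    2 + k                 ≤⟨ +-monoʳ-≤ 2 (k≤1+2*⌊k/2⌋ k) ⟩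
    2 + suc (2 * ⌊ k /2⌋) ≡⟨ cong suc (*-distribˡ-+ 2 1 ⌊ k /2⌋) ⟨
    suc (2 * suc ⌊ k /2⌋) ∎
    where open ≤-Reasoning

  n≤n! : ∀ n → n ≤ n !
  n≤n! zero    = z≤n
  n≤n! (suc n) = m≤m*n (suc n) (n !) {{n !≢0}}

  n!≤2^[n*n] : ∀ n → n ! ≤ 2 ^ (n * n)
  n!≤2^[n*n] zero    = ≤-refl
  n!≤2^[n*n] (suc n) = begin
    suc n * n !             ≤⟨ *-mono-≤ (<⇒≤ (n<2^n (suc n))) (n!≤2^[n*n] n) ⟩
    2 ^ suc n * 2 ^ (n * n) ≡⟨ ^-distribˡ-+-* 2 (suc n) (n * n) ⟨
    2 ^ (suc n + n * n)     ≤⟨ ^-monoʳ-≤ 2 (+-monoʳ-≤ (suc n) (*-monoʳ-≤ n (n≤1+n n))) ⟩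
    2 ^ (suc n * suc n)     ∎
    where open ≤-Reasoning

  p^e∣[e*p]! : ∀ p e .{{_ : NonZero p}} → p ^ e ∣ (e * p) !
  p^e∣[e*p]! p         zero    = 1∣ 1
  p^e∣[e*p]! p@(suc q) (suc e) =
    *-pres-∣ (n∣m*n (suc e) {p}) (∣-trans (p^e∣[e*p]! p e) (m≤n⇒m!∣n! (m≤n+m (e * p) q)))

  m!≡p^e*r⇒m<[1+e]*p : ∀ {p e r} m .{{_ : NonZero p}} → ¬ p ∣ r → m ! ≡ p ^ e * r → m < suc e * p
  m!≡p^e*r⇒m<[1+e]*p {p} {e} m p∤r m!≡p^e*r = ≰⇒> λ [1+e]*p≤m →
    p∤r (*-cancelˡ-∣ (p ^ e) {{m^n≢0 p e}} (subst₂ _∣_ (*-comm p (p ^ e)) m!≡p^e*r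
      (∣-trans (p^e∣[e*p]! p (suc e)) (m≤n⇒m!∣n! [1+e]*p≤m))))

  [1+k+μ*j]*p≤[1+k+μ]*p*[1+j] : ∀ k μ j p → suc (k + μ * j) * p ≤ (suc k + μ) * p * suc j
  [1+k+μ*j]*p≤[1+k+μ]*p*[1+j] k μ j p = begin
    suc (k + μ * j) * p                     ≤⟨ *-monoˡ-≤ p (m≤m+n (suc (k + μ * j)) (μ + suc k * j)) ⟩
    (suc (k + μ * j) + (μ + suc k * j)) * p ≡⟨ expand k μ j p ⟩
    (suc k + μ) * p * suc j                 ∎
    where
    open ≤-Reasoning
    expand : ∀ k μ j p → (1 + (k + μ * j) + (μ + (1 + k) * j)) * p ≡ (1 + k + μ) * p * (1 + j)
    expand = solve-∀

  m≤A*[1+j]⇒2m²+D≤[2A²+D]*[1+j]² : ∀ {m} A j D → m ≤ A * suc j →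
    2 * (m * m) + D ≤ (2 * (A * A) + D) * (suc j * suc j)
  m≤A*[1+j]⇒2m²+D≤[2A²+D]*[1+j]² {m} A j D m≤A[1+j] = begin
    2 * (m * m) + D
      ≤⟨ +-mono-≤ (*-monoʳ-≤ 2 (*-mono-≤ m≤A[1+j] m≤A[1+j])) (m≤m*n D (suc j * suc j)) ⟩
    2 * (A * suc j * (A * suc j)) + D * (suc j * suc j) ≡⟨ expand A j D ⟩
    (2 * (A * A) + D) * (suc j * suc j)                 ∎
    where
    open ≤-Reasoning
    expand : ∀ A j D → 2 * (A * (1 + j) * (A * (1 + j))) + D * ((1 + j) * (1 + j)) ≡
                       (2 * (A * A) + D) * ((1 + j) * (1 + j))
    expand = solve-∀

module BoundedSets where

  open import Data.Nat
  open import Data.Nat.Properties using (≤-refl; m<n⇒m<1+n; m<1+n⇒m<n∨m≡n; m≤n⇒m≤n⊔o; m≤n⇒m≤o⊔n)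
  open import Data.Product using (∃-syntax; _×_; _,_)
  open import Data.Sum using (inj₁; inj₂)
  open import Level using (Level)
  open import Relation.Unary using (Pred; _⊆_; _∪_)
  open import Relation.Binary.PropositionalEquality using (refl)

  private variable
    ℓ ℓ₁ ℓ₂ : Level
    S : Pred ℕ ℓ₁
    T : Pred ℕ ℓ₂

  Bounded : Pred ℕ ℓ → Set ℓ
  Bounded S = ∃[ M ] (S ⊆ (_≤ M))

  Bounded-⊆ : S ⊆ T → Bounded T → Bounded S
  Bounded-⊆ S⊆T (M , T≤M) = M , λ m∈S → T≤M (S⊆T m∈S)

  Bounded-∪ : Bounded S → Bounded T → Bounded (S ∪ T)
  Bounded-∪ (M , S≤M) (M′ , T≤M′) = M ⊔ M′ , λ where
    (inj₁ m∈S) → m≤n⇒m≤n⊔o M′ (S≤M m∈S)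
    (inj₂ m∈T) → m≤n⇒m≤o⊔n M  (T≤M′ m∈T)

  Bounded-⋃< : ∀ n (S : ℕ → Pred ℕ ℓ) → (∀ i → i < n → Bounded (S i)) →
    Bounded (λ m → ∃[ i ] (i < n × S i m))
  Bounded-⋃< zero    S _         = 0 , λ ()
  Bounded-⋃< (suc n) S bounded-S = Bounded-⊆ split
    (Bounded-∪ (Bounded-⋃< n S (λ i i<n → bounded-S i (m<n⇒m<1+n i<n))) (bounded-S n ≤-refl))
    where
    split : (λ m → ∃[ i ] (i < suc n × S i m)) ⊆ ((λ m → ∃[ i ] (i < n × S i m)) ∪ S n)
    split (i , i<1+n , m∈Sᵢ) with m<1+n⇒m<n∨m≡n i<1+n
    ... | inj₁ i<n  = inj₁ (i , i<n , m∈Sᵢ)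
    ... | inj₂ refl = inj₂ m∈Sᵢ

module Recurrences where

  open import Algebra.Bundles.Raw using (RawSemiring)
  open import Data.Nat
  open import Data.Nat.Properties
  open import Data.Product using (_×_; _,_; proj₁)
  open import Function using (_∘_)
  open import Level using (Level)
  open import Relation.Binary.PropositionalEquality using (_≡_; refl; trans; cong; cong₂; module ≡-Reasoning)
  open Arithmetic using (2^m≤2^n⇒m≤n; k≤1+2*⌊k/2⌋; n!≤2^[n*n])

  private variable
    ℓ ℓ′ : Level
    A B : Set ℓ

  recurrence₃ : (A → A → A → A) → A → A → A → ℕ → A
  recurrence₃ f u₀ u₁ u₂ 0 = u₀
  recurrence₃ f u₀ u₁ u₂ 1 = u₁
  recurrence₃ f u₀ u₁ u₂ 2 = u₂
  recurrence₃ f u₀ u₁ u₂ (suc (suc (suc k))) =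
    f (recurrence₃ f u₀ u₁ u₂ (suc (suc k))) (recurrence₃ f u₀ u₁ u₂ (suc k)) (recurrence₃ f u₀ u₁ u₂ k)

  Satisfies₃ : (A → A → A → A) → (ℕ → A) → Set _
  Satisfies₃ f s = ∀ k → s (3 + k) ≡ f (s (2 + k)) (s (1 + k)) (s k)

  satisfies₃-map : ∀ {f : A → A → A → A} {g : B → B → B → B} {s} (h : A → B) →
    (∀ u v w → h (f u v w) ≡ g (h u) (h v) (h w)) → Satisfies₃ f s → Satisfies₃ g (h ∘ s)
  satisfies₃-map h h-hom s-rec k = trans (cong h (s-rec k)) (h-hom _ _ _)

  satisfies₃-unique : ∀ {f : A → A → A → A} {s t} → Satisfies₃ f s → Satisfies₃ f t →
    s 0 ≡ t 0 → s 1 ≡ t 1 → s 2 ≡ t 2 → ∀ k → s k ≡ t k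
  satisfies₃-unique {f = f} {s} {t} s-rec t-rec s₀≡t₀ s₁≡t₁ s₂≡t₂ k = proj₁ (agree k)
    where
    agree : ∀ k → s k ≡ t k × s (1 + k) ≡ t (1 + k) × s (2 + k) ≡ t (2 + k)
    agree zero    = s₀≡t₀ , s₁≡t₁ , s₂≡t₂
    agree (suc k) with agree k
    ... | eq₀ , eq₁ , eq₂ = eq₁ , eq₂ , (begin
      s (3 + k)                       ≡⟨ s-rec k ⟩
      f (s (2 + k)) (s (1 + k)) (s k) ≡⟨ cong₂ (λ v w → f v w (s k)) eq₂ eq₁ ⟩
      f (t (2 + k)) (t (1 + k)) (s k) ≡⟨ cong (f (t (2 + k)) (t (1 + k))) eq₀ ⟩
      f (t (2 + k)) (t (1 + k)) (t k) ≡⟨ t-rec k ⟨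
      t (3 + k)                       ∎)
      where open ≡-Reasoning

  recurrence₃-image : ∀ {f : A → A → A → A} {g : B → B → B → B} {s} (h : A → B) →
    (∀ u v w → h (f u v w) ≡ g (h u) (h v) (h w)) → Satisfies₃ g s →
    ∀ {u₀ u₁ u₂} → s 0 ≡ h u₀ → s 1 ≡ h u₁ → s 2 ≡ h u₂ → ∀ k → s k ≡ h (recurrence₃ f u₀ u₁ u₂ k)
  recurrence₃-image {f = f} {g} h h-hom s-rec {u₀} {u₁} {u₂} =
    satisfies₃-unique {f = g} s-rec (satisfies₃-map {f = f} {g} {recurrence₃ f u₀ u₁ u₂} h h-hom (λ _ → refl))

  linear₃ : (R : RawSemiring ℓ ℓ′) → let open RawSemiring R in
    Carrier → Carrier → Carrier → Carrier → Carrier → Carrier → Carrier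
  linear₃ R a b c u v w = a *ᴿ u +ᴿ b *ᴿ v +ᴿ c *ᴿ w
    where open RawSemiring R using () renaming (_+_ to _+ᴿ_; _*_ to _*ᴿ_)

  module LinearRecurrenceGrowth (a b c : ℕ) .{{_ : NonZero a}} .{{_ : NonZero b}}
    {u : ℕ → ℕ} (u-rec : Satisfies₃ (linear₃ +-*-rawSemiring a b c) u) where

    u[2+k]+u[1+k]≤u[3+k] : ∀ k → u (2 + k) + u (1 + k) ≤ u (3 + k)
    u[2+k]+u[1+k]≤u[3+k] k = begin
      u (2 + k) + u (1 + k)
        ≤⟨ +-mono-≤ (m≤n*m (u (2 + k)) a) (m≤n*m (u (1 + k)) b) ⟩
      a * u (2 + k) + b * u (1 + k)           ≤⟨ m≤m+n _ (c * u k) ⟩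
      a * u (2 + k) + b * u (1 + k) + c * u k ≡⟨ u-rec k ⟨
      u (3 + k)                               ∎
      where open ≤-Reasoning

    u[2+k]≤u[3+k] : ∀ k → u (2 + k) ≤ u (3 + k)
    u[2+k]≤u[3+k] k = ≤-trans (m≤m+n _ _) (u[2+k]+u[1+k]≤u[3+k] k)

    2^⌊k/2⌋*u[2]≤u[2+k] : ∀ k → 2 ^ ⌊ k /2⌋ * u 2 ≤ u (2 + k)
    2^⌊k/2⌋*u[2]≤u[2+k] 0             = ≤-reflexive (*-identityˡ (u 2))
    2^⌊k/2⌋*u[2]≤u[2+k] 1             = ≤-trans (≤-reflexive (*-identityˡ (u 2))) (u[2+k]≤u[3+k] 0)
    2^⌊k/2⌋*u[2]≤u[2+k] (suc (suc k)) = begin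
      2 * 2 ^ ⌊ k /2⌋ * u 2   ≡⟨ *-assoc 2 (2 ^ ⌊ k /2⌋) (u 2) ⟩
      2 * (2 ^ ⌊ k /2⌋ * u 2) ≤⟨ *-monoʳ-≤ 2 (2^⌊k/2⌋*u[2]≤u[2+k] k) ⟩
      2 * u (2 + k)           ≡⟨ cong (u (2 + k) +_) (+-identityʳ (u (2 + k))) ⟩
      u (2 + k) + u (2 + k)   ≤⟨ +-monoˡ-≤ (u (2 + k)) (u[2+k]≤u[3+k] k) ⟩
      u (3 + k) + u (2 + k)   ≤⟨ u[2+k]+u[1+k]≤u[3+k] (suc k) ⟩
      u (4 + k)               ∎
      where open ≤-Reasoning

    u[k]≡m!⇒k≤2*m*m+3 : 1 ≤ u 2 → ∀ k m → u k ≡ m ! → k ≤ 2 * (m * m) + 3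
    u[k]≡m!⇒k≤2*m*m+3 _    0             _ _         = z≤n
    u[k]≡m!⇒k≤2*m*m+3 _    1             _ _         = ≤-trans (s≤s z≤n) (m≤n+m 3 _)
    u[k]≡m!⇒k≤2*m*m+3 1≤u₂ (suc (suc k)) m u[2+k]≡m! = begin
      2 + k           ≤⟨ +-monoʳ-≤ 2 (k≤1+2*⌊k/2⌋ k) ⟩
      3 + 2 * ⌊ k /2⌋ ≤⟨ +-monoʳ-≤ 3 (*-monoʳ-≤ 2 ⌊k/2⌋≤m*m) ⟩
      3 + 2 * (m * m) ≡⟨ +-comm 3 _ ⟩
      2 * (m * m) + 3 ∎
      where
      open ≤-Reasoning
      ⌊k/2⌋≤m*m : ⌊ k /2⌋ ≤ m * m
      ⌊k/2⌋≤m*m = 2^m≤2^n⇒m≤n (begin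
        2 ^ ⌊ k /2⌋       ≤⟨ m≤m*n (2 ^ ⌊ k /2⌋) (u 2) {{>-nonZero 1≤u₂}} ⟩
        2 ^ ⌊ k /2⌋ * u 2 ≤⟨ 2^⌊k/2⌋*u[2]≤u[2+k] k ⟩
        u (2 + k)         ≡⟨ u[2+k]≡m! ⟩
        m !               ≤⟨ n!≤2^[n*n] m ⟩
        2 ^ (m * m)       ∎)

module Rationals where

  open import Defs
  open import Data.Nat as ℕ using (ℕ; suc; NonZero)
  open import Data.Integer as ℤ using (ℤ; +_; ∣_∣)
  import Data.Integer.Properties as ℤ
  open import Data.Rational as ℚ using (ℚ; mkℚ; ↥_; ↧ₙ_; 0ℚ; 1ℚ; _+_; _*_; _-_; -_; _≤_; _<_)
  import Data.Rational.Properties as ℚ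
  import Data.Nat.Coprimality as Coprime
  open import Data.Product using (∃; ∃-syntax; _×_; _,_; proj₁)
  open import Relation.Binary.PropositionalEquality using (_≡_; refl; sym; trans; cong; cong₂; subst; subst₂; module ≡-Reasoning)
  open Recurrences using (recurrence₃; Satisfies₃; recurrence₃-image; linear₃)

  ℤ→ℚ≡mkℚ : ∀ z → ℤ→ℚ z ≡ mkℚ z 0 (Coprime.sym (Coprime.1-coprimeTo ∣ z ∣))
  ℤ→ℚ≡mkℚ z = ℚ.↥p/↧p≡p (mkℚ z 0 (Coprime.sym (Coprime.1-coprimeTo ∣ z ∣)))

  ↥-ℤ→ℚ : ∀ z → ↥ ℤ→ℚ z ≡ z
  ↥-ℤ→ℚ z = cong ↥_ (ℤ→ℚ≡mkℚ z)

  ↧ₙ-ℤ→ℚ : ∀ z → ↧ₙ ℤ→ℚ z ≡ 1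
  ↧ₙ-ℤ→ℚ z = cong ↧ₙ_ (ℤ→ℚ≡mkℚ z)

  ℤ→ℚ-injective : ∀ {u v} → ℤ→ℚ u ≡ ℤ→ℚ v → u ≡ v
  ℤ→ℚ-injective {u} {v} eq = trans (sym (↥-ℤ→ℚ u)) (trans (cong ↥_ eq) (↥-ℤ→ℚ v))

  ℤ→ℚ-homo-+ : ∀ u v → ℤ→ℚ (u ℤ.+ v) ≡ ℤ→ℚ u + ℤ→ℚ v
  ℤ→ℚ-homo-+ u v rewrite ℤ→ℚ≡mkℚ u | ℤ→ℚ≡mkℚ v =
    cong ℤ→ℚ (sym (cong₂ ℤ._+_ (ℤ.*-identityʳ u) (ℤ.*-identityʳ v)))

  ℤ→ℚ-homo-* : ∀ u v → ℤ→ℚ (u ℤ.* v) ≡ ℤ→ℚ u * ℤ→ℚ v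
  ℤ→ℚ-homo-* u v rewrite ℤ→ℚ≡mkℚ u | ℤ→ℚ≡mkℚ v = refl

  ℤ→ℚ-homo-linear₃ : ∀ a b c u v w →
    ℤ→ℚ (linear₃ ℤ.+-*-rawSemiring a b c u v w) ≡
    linear₃ ℚ.+-*-rawSemiring (ℤ→ℚ a) (ℤ→ℚ b) (ℤ→ℚ c) (ℤ→ℚ u) (ℤ→ℚ v) (ℤ→ℚ w)
  ℤ→ℚ-homo-linear₃ a b c u v w = begin
    ℤ→ℚ (a ℤ.* u ℤ.+ b ℤ.* v ℤ.+ c ℤ.* w)
      ≡⟨ ℤ→ℚ-homo-+ (a ℤ.* u ℤ.+ b ℤ.* v) (c ℤ.* w) ⟩
    ℤ→ℚ (a ℤ.* u ℤ.+ b ℤ.* v) + ℤ→ℚ (c ℤ.* w)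
      ≡⟨ cong (_+ ℤ→ℚ (c ℤ.* w)) (ℤ→ℚ-homo-+ (a ℤ.* u) (b ℤ.* v)) ⟩
    ℤ→ℚ (a ℤ.* u) + ℤ→ℚ (b ℤ.* v) + ℤ→ℚ (c ℤ.* w)
      ≡⟨ cong₂ _+_ (cong₂ _+_ (ℤ→ℚ-homo-* a u) (ℤ→ℚ-homo-* b v)) (ℤ→ℚ-homo-* c w) ⟩
    ℤ→ℚ a * ℤ→ℚ u + ℤ→ℚ b * ℤ→ℚ v + ℤ→ℚ c * ℤ→ℚ w
      ∎
    where open ≡-Reasoning

  +-homo-linear₃ : ∀ a b c u v w →
    + linear₃ ℕ.+-*-rawSemiring a b c u v w ≡ linear₃ ℤ.+-*-rawSemiring (+ a) (+ b) (+ c) (+ u) (+ v) (+ w)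
  +-homo-linear₃ a b c u v w = cong₂ ℤ._+_ (cong₂ ℤ._+_ (ℤ.pos-* a u) (ℤ.pos-* b v)) (ℤ.pos-* c w)

  ℤ→ℚ-mono-≤ : ∀ {u v} → u ℤ.≤ v → ℤ→ℚ u ≤ ℤ→ℚ v
  ℤ→ℚ-mono-≤ {u} {v} u≤v rewrite ℤ→ℚ≡mkℚ u | ℤ→ℚ≡mkℚ v =
    ℚ.*≤* (subst₂ ℤ._≤_ (sym (ℤ.*-identityʳ u)) (sym (ℤ.*-identityʳ v)) u≤v)

  ℤ→ℚ-cancel-≤ : ∀ {u v} → ℤ→ℚ u ≤ ℤ→ℚ v → u ℤ.≤ v
  ℤ→ℚ-cancel-≤ {u} {v} u≤v rewrite ℤ→ℚ≡mkℚ u | ℤ→ℚ≡mkℚ v with u≤v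
  ... | ℚ.*≤* u*1≤v*1 = subst₂ ℤ._≤_ (ℤ.*-identityʳ u) (ℤ.*-identityʳ v) u*1≤v*1

  natural-tail : ∀ a b c {s} → Satisfies₃ (linear₃ ℚ.+-*-rawSemiring (ℕ→ℚ a) (ℕ→ℚ b) (ℕ→ℚ c)) s →
    (∃[ z ] s 0 ≡ ℤ→ℚ z) → (∃[ z ] s 1 ≡ ℤ→ℚ z) → (∃[ z ] s 2 ≡ ℤ→ℚ z) →
    0ℚ ≤ s 1 → 0ℚ ≤ s 2 → 0ℚ ≤ s 3 →
    ∃[ u ] (Satisfies₃ (linear₃ ℕ.+-*-rawSemiring a b c) u × ∀ k → s (suc k) ≡ ℕ→ℚ (u k))
  natural-tail a b c {s} s-rec (z₀ , s₀≡z₀) (z₁ , s₁≡z₁) (z₂ , s₂≡z₂) 0≤s₁ 0≤s₂ 0≤s₃ =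
    u , (λ _ → refl) , λ k → trans (s≡y (suc k)) (cong ℤ→ℚ (y≡u k))
    where
    y : ℕ → ℤ
    y = recurrence₃ (linear₃ ℤ.+-*-rawSemiring (+ a) (+ b) (+ c)) z₀ z₁ z₂
    s≡y : ∀ k → s k ≡ ℤ→ℚ (y k)
    s≡y = recurrence₃-image {g = linear₃ ℚ.+-*-rawSemiring (ℕ→ℚ a) (ℕ→ℚ b) (ℕ→ℚ c)}
            ℤ→ℚ (ℤ→ℚ-homo-linear₃ (+ a) (+ b) (+ c)) s-rec s₀≡z₀ s₁≡z₁ s₂≡z₂
    y≡+∣y∣ : ∀ k → 0ℚ ≤ s k → y k ≡ + ∣ y k ∣
    y≡+∣y∣ k 0≤sₖ = sym (ℤ.0≤i⇒+∣i∣≡i (ℤ→ℚ-cancel-≤ (subst (0ℚ ≤_) (s≡y k) 0≤sₖ)))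
    u : ℕ → ℕ
    u = recurrence₃ (linear₃ ℕ.+-*-rawSemiring a b c) (∣ y 1 ∣) (∣ y 2 ∣) (∣ y 3 ∣)
    y≡u : ∀ k → y (suc k) ≡ + u k
    y≡u = recurrence₃-image {g = linear₃ ℤ.+-*-rawSemiring (+ a) (+ b) (+ c)}
            +_ (+-homo-linear₃ a b c) (λ _ → refl) (y≡+∣y∣ 1 0≤s₁) (y≡+∣y∣ 2 0≤s₂) (y≡+∣y∣ 3 0≤s₃)

  module DominantRoot (a b c : ℕ) .{{_ : NonZero a}} .{{_ : NonZero c}} where

    charPoly<0 : ∀ {q} → 0ℚ < q → q ≤ 1ℚ → charPoly a b c q < 0ℚ
    charPoly<0 {q} 0<q q≤1 = ℚ.+-mono-≤-< (ℚ.+-mono-≤ q³-Aq²≤0 -Bq≤0) -C<0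
      where
      A B C : ℚ
      A = ℕ→ℚ a
      B = ℕ→ℚ b
      C = ℕ→ℚ c
      instance
        _ : ℚ.NonNegative q
        _ = ℚ.pos⇒nonNeg q {{ℚ.positive 0<q}}
        _ : ℚ.NonNegative (B * q)
        _ = ℚ.nonNeg*nonNeg⇒nonNeg B {{ℚ.normalize-nonNeg b 1}} q
        _ : ℚ.Positive C
        _ = ℚ.normalize-pos c 1
      q≤A : q ≤ A
      q≤A = ℚ.≤-trans q≤1 (ℤ→ℚ-mono-≤ (ℤ.+≤+ (ℕ.>-nonZero⁻¹ a)))
      q³-Aq²≤0 : q * q * q - A * q * q ≤ 0ℚ
      q³-Aq²≤0 = begin
        q * q * q - A * q * q
          ≤⟨ ℚ.+-monoˡ-≤ (- (A * q * q)) (ℚ.*-monoʳ-≤-nonNeg q (ℚ.*-monoʳ-≤-nonNeg q q≤A)) ⟩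
        A * q * q - A * q * q ≡⟨ ℚ.+-inverseʳ (A * q * q) ⟩
        0ℚ                    ∎
        where open ℚ.≤-Reasoning
      -Bq≤0 : - (B * q) ≤ 0ℚ
      -Bq≤0 = ℚ.neg-antimono-≤ (ℚ.nonNegative⁻¹ (B * q))
      -C<0 : - C < 0ℚ
      -C<0 = ℚ.neg-antimono-< (ℚ.positive⁻¹ C)

    InU⇒1<q : ∀ {q} → InU a b c q → 1ℚ < q
    InU⇒1<q (0<q , 0≤P) = ℚ.≰⇒> λ q≤1 → ℚ.<-irrefl refl (ℚ.≤-<-trans 0≤P (charPoly<0 0<q q≤1))

    γ≤r⇒1≤r : ∀ {r} → γ[ a , b , c ]≤ r → 1ℚ ≤ r
    γ≤r⇒1≤r γ≤r = ℚ.≮⇒≥ λ r<1 → let q , q∈U , q≤1 = γ≤r 1ℚ r<1 in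
      ℚ.<-irrefl refl (ℚ.<-≤-trans (InU⇒1<q q∈U) q≤1)

    γ≤r⇒U≢∅ : ∀ {r} → γ[ a , b , c ]≤ r → ∃ (InU a b c)
    γ≤r⇒U≢∅ {r} γ≤r = let q , q∈U , _ = γ≤r (r + 1ℚ) r<r+1 in q , q∈U
      where
      r<r+1 : r < r + 1ℚ
      r<r+1 = subst (_< r + 1ℚ) (ℚ.+-identityʳ r) (ℚ.+-monoʳ-< r (ℚ.positive⁻¹ 1ℚ))

    γ⁻¹≤r⇒0<r : ∀ {r} → ∃ (InU a b c) → γ⁻¹[ a , b , c ]≤ r → 0ℚ < r
    γ⁻¹≤r⇒0<r {r} (q , q∈U) γ⁻¹≤r = ℚ.≰⇒> λ r≤0 → ℚ.<-irrefl refl (begin-strict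
      0ℚ     <⟨ ℚ.positive⁻¹ 1ℚ ⟩
      1ℚ     ≤⟨ γ⁻¹≤r q q∈U ⟩
      q * r  ≤⟨ ℚ.*-monoˡ-≤-nonNeg q r≤0 ⟩
      q * 0ℚ ≡⟨ ℚ.*-zeroʳ q ⟩
      0ℚ     ∎)
      where
      open ℚ.≤-Reasoning
      instance
        _ : ℚ.NonNegative q
        _ = ℚ.pos⇒nonNeg q {{ℚ.positive (proj₁ q∈U)}}

module Valuations where

  open import Defs
  open import Data.Nat
  open import Data.Nat.Properties
  open import Data.Nat.Divisibility using (_∣_; ∣1⇒≡1; m∣m*n; ∣m⇒∣m*n; _∣0)
  open import Data.Integer as ℤ using (ℤ; +_; -[1+_]; ∣_∣)
  import Data.Integer.Properties as ℤ
  open import Data.Product using (∃-syntax; _×_; _,_)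
  open import Data.Empty using (⊥-elim)
  open import Relation.Nullary using (¬_)
  open import Relation.Binary.PropositionalEquality using (_≡_; refl; sym; trans; cong; subst)
  open Arithmetic using (m!≡p^e*r⇒m<[1+e]*p)
  open Rationals using (↥-ℤ→ℚ; ↧ₙ-ℤ→ℚ; ℤ→ℚ-injective)

  fin-injective : ∀ {k l} → fin k ≡ fin l → k ≡ l
  fin-injective refl = refl

  module _ {p : ℕ} .{{_ : NonTrivial p}} where

    private instance
      _ : NonZero p
      _ = nonTrivial⇒nonZero p

    p∤1 : ¬ p ∣ 1
    p∤1 p∣1 = <-irrefl (sym (∣1⇒≡1 p∣1)) (nonTrivial⇒n>1 p)

    -- The denominator of ℤ→ℚ z is 1, so its valuation cannot be negative.
    ValFin-ℤ→ℚ : ∀ {z k} → ValFin p (ℤ→ℚ z) k →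
      ∃[ e ] (k ≡ + e × ∃[ r ] (∣ z ∣ ≡ p ^ e * r × ¬ p ∣ r))
    ValFin-ℤ→ℚ {z} {+ e} ((r , ∣↥z∣≡p^e*r , p∤r) , _) =
      e , refl , r , subst (λ t → ∣ t ∣ ≡ p ^ e * r) (↥-ℤ→ℚ z) ∣↥z∣≡p^e*r , p∤r
    ValFin-ℤ→ℚ {z} { -[1+ k ]} (_ , d , ↧z≡p^[1+k]*d , _) =
      ⊥-elim (p∤1 (subst (p ∣_) (trans (sym ↧z≡p^[1+k]*d) (↧ₙ-ℤ→ℚ z)) (∣m⇒∣m*n d (m∣m*n (p ^ k)))))

    HasValℤ-fin⇒p^j≤∣z∣ : ∀ {z k} → HasValℤ p z (fin k) → ∃[ j ] (k ≡ + j × p ^ j ≤ ∣ z ∣)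
    HasValℤ-fin⇒p^j≤∣z∣ {z} z≐k with ValFin-ℤ→ℚ {z} z≐k
    ... | j , k≡j , zero  , _         , p∤0 = ⊥-elim (p∤0 (p ∣0))
    ... | j , k≡j , suc r , ∣z∣≡p^j*r , _   =
      j , k≡j , subst (p ^ j ≤_) (sym ∣z∣≡p^j*r) (m≤m*n (p ^ j) (suc r))

    HasVal-m!⇒m<[1+e]*p : ∀ {v} m → HasVal p (ℕ→ℚ (m !)) v → ∃[ e ] (v ≡ fin (+ e) × m < suc e * p)
    HasVal-m!⇒m<[1+e]*p {∞} m m!≡0 =
      ⊥-elim (≢-nonZero⁻¹ (m !) {{m !≢0}} (ℤ.+-injective (ℤ→ℚ-injective m!≡0)))
    HasVal-m!⇒m<[1+e]*p {fin k} m m!≐k with ValFin-ℤ→ℚ {+ (m !)} m!≐k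
    ... | e , refl , r , m!≡p^e*r , p∤r = e , refl , m!≡p^e*r⇒m<[1+e]*p {e = e} m p∤r m!≡p^e*r

    HasVal-m!-affine⇒m<[1+∣κ∣+μ*j]*p : ∀ {z v κ μ} m →
      HasValℤ p z v → HasVal p (ℕ→ℚ (m !)) (affine κ μ v) →
      ∃[ j ] (p ^ j ≤ ∣ z ∣ × m < suc (∣ κ ∣ + μ * j) * p)
    HasVal-m!-affine⇒m<[1+∣κ∣+μ*j]*p {v = ∞} {κ} {μ} m _ m!≐∞
      with HasVal-m!⇒m<[1+e]*p {affine κ μ ∞} m m!≐∞
    ... | _ , () , _
    HasVal-m!-affine⇒m<[1+∣κ∣+μ*j]*p {z} {fin k} {κ} {μ} m z≐k m!≐κ+μk
      with HasValℤ-fin⇒p^j≤∣z∣ {z} z≐k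
    ... | j , refl , p^j≤∣z∣ with HasVal-m!⇒m<[1+e]*p m m!≐κ+μk
    ...   | e , κ+μj≡e , m<[1+e]*p =
      j , p^j≤∣z∣ , <-≤-trans m<[1+e]*p (*-monoˡ-≤ p (s≤s e≤∣κ∣+μj))
      where
      e≤∣κ∣+μj : e ≤ ∣ κ ∣ + μ * j
      e≤∣κ∣+μj = begin
        e                       ≡⟨ cong ∣_∣ (fin-injective κ+μj≡e) ⟨
        ∣ κ ℤ.+ + μ ℤ.* + j ∣   ≤⟨ ℤ.∣i+j∣≤∣i∣+∣j∣ κ (+ μ ℤ.* + j) ⟩
        ∣ κ ∣ + ∣ + μ ℤ.* + j ∣ ≡⟨ cong (λ t → ∣ κ ∣ + t) (ℤ.abs-* (+ μ) (+ j)) ⟩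
        ∣ κ ∣ + μ * j           ∎
        where open ≤-Reasoning

module FactorialSolutions where

  open import Defs
  open import Data.Nat
  open import Data.Nat.Properties
  open import Data.Nat.DivMod using (_/_; _%_; m≡m%n+[m/n]*n; m%n<n; m%n≤m)
  open import Data.Nat.Divisibility using (divides)
  open import Data.Integer as ℤ using (ℤ; +_; ∣_∣)
  import Data.Integer.Properties as ℤ
  import Data.Integer.Divisibility as ℤ
  open import Data.Rational using (ℚ)
  open import Data.Product using (∃-syntax; _×_; _,_)
  open import Data.Sum using (inj₁; inj₂; [_,_])
  open import Level using (Level)
  open import Relation.Unary using (Pred; _⊆_; _∪_; U)
  open import Relation.Binary.PropositionalEquality using (_≡_; refl; sym; trans; cong; subst; module ≡-Reasoning)
  open Arithmetic
  open BoundedSets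
  open Rationals using (ℤ→ℚ-injective)
  open Valuations

  InClass : ℕ → ℕ → ℕ → Set
  InClass Q i n = (+ Q) ℤ.∣ (+ n ℤ.- + i)

  InClass-% : ∀ Q n .{{_ : NonZero Q}} → InClass Q (n % Q) n
  InClass-% Q n = divides (n / Q) (begin
    ∣ + n ℤ.- + (n % Q) ∣     ≡⟨ cong ∣_∣ (trans (ℤ.m-n≡m⊖n n (n % Q)) (ℤ.⊖-≥ (m%n≤m n Q))) ⟩
    n ∸ n % Q                 ≡⟨ cong (_∸ n % Q) (m≡m%n+[m/n]*n n Q) ⟩
    n % Q + n / Q * Q ∸ n % Q ≡⟨ m+n∸m≡n (n % Q) (n / Q * Q) ⟩
    n / Q * Q                 ∎)
    where open ≡-Reasoning

  private variable
    ℓ : Level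

  module _ (x : ℤ → ℚ) (u : ℕ → ℕ) (x≡u : ∀ k → x (+ suc k) ≡ ℕ→ℚ (u k))
    (u-index≤ : ∀ k m → u k ≡ m ! → k ≤ 2 * (m * m) + 3) where

    -- A data type rather than a Σ-type, so that unification can recover m.
    data Solutions (P : Pred ℕ ℓ) (m : ℕ) : Set ℓ where
      solution : ∀ n → P n → 1 ≤ n → x (+ n) ≡ ℕ→ℚ (m !) → Solutions P m

    u≡m! : ∀ k m → x (+ suc k) ≡ ℕ→ℚ (m !) → u k ≡ m !
    u≡m! k m x≡m! = ℤ.+-injective (ℤ→ℚ-injective (trans (sym (x≡u k)) x≡m!))

    index≤ : ∀ n m → 1 ≤ n → x (+ n) ≡ ℕ→ℚ (m !) → n ≤ 2 * (m * m) + 4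
    index≤ (suc k) m _ x≡m! =
      subst (suc k ≤_) (sym (+-suc (2 * (m * m)) 3)) (s≤s (u-index≤ k m (u≡m! k m x≡m!)))

    solutions-below : ∀ N → Bounded (Solutions (_≤ N))
    solutions-below N = Bounded-⊆ m≤u (Bounded-⋃< N (λ k → _≤ u k) (λ k _ → u k , λ m≤uₖ → m≤uₖ))
      where
      m≤u : Solutions (_≤ N) ⊆ (λ m → ∃[ k ] (k < N × m ≤ u k))
      m≤u {m} (solution (suc k) k<N _ x≡m!) =
        k , k<N , ≤-trans (n≤n! m) (≤-reflexive (sym (u≡m! k m x≡m!)))

    solutions-cofinite : ∀ {P : Pred ℕ ℓ} N → Bounded (Solutions (λ n → P n × N ≤ n)) → Bounded (Solutions P)
    solutions-cofinite {P = P} N bounded = Bounded-⊆ split (Bounded-∪ (solutions-below N) bounded)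
      where
      split : Solutions P ⊆ (Solutions (_≤ N) ∪ Solutions (λ n → P n × N ≤ n))
      split (solution n n∈P 1≤n x≡m!) with ≤-total n N
      ... | inj₁ n≤N = inj₁ (solution n n≤N 1≤n x≡m!)
      ... | inj₂ N≤n = inj₂ (solution n (n∈P , N≤n) 1≤n x≡m!)

    module _ {p : ℕ} .{{_ : NonTrivial p}} where

      solutions-C : ∀ {Q i} → CaseC p x Q i → Bounded (Solutions (InClass Q i))
      solutions-C {Q} {i} (κ , N , valuation) = solutions-cofinite N (suc κ * p , m≤)
        where
        m≤ : Solutions (λ n → InClass Q i n × N ≤ n) ⊆ (_≤ suc κ * p)
        m≤ {m} (solution n (n∈i , N≤n) _ x≡m!)
          with HasVal-m!⇒m<[1+e]*p {v = fin (+ κ)} m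
                 (subst (λ r → HasVal p r (fin (+ κ))) x≡m! (valuation (+ n) n∈i N≤n))
        ... | _ , refl , m< = <⇒≤ m<

      solutions-L : ∀ {Q i} → CaseL p x Q i → Bounded (Solutions (InClass Q i))
      solutions-L {Q} {i} (a , κ , μ , _ , _ , N , valuation) = solutions-cofinite N (A * (27 * C) , m≤)
        where
        A C : ℕ
        A = (suc ∣ κ ∣ + μ) * p
        C = 2 * (A * A) + (4 + ∣ a ∣)
        m≤ : Solutions (λ n → InClass Q i n × N ≤ n) ⊆ (_≤ A * (27 * C))
        m≤ {m} (solution n (n∈i , N≤n) 1≤n x≡m!) with valuation (+ n) n∈i N≤n
        ... | v , n-a≐v , xₙ≐κ+μv
          with HasVal-m!-affine⇒m<[1+∣κ∣+μ*j]*p {z = + n ℤ.- a} {v} {κ} {μ} m n-a≐v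
                 (subst (λ r → HasVal p r (affine κ μ v)) x≡m! xₙ≐κ+μv)
        ...   | j , p^j≤∣n-a∣ , m< = ≤-trans m≤A*[1+j] (*-monoʳ-≤ A (2^n≤c*[1+n]²⇒n<27*c C j 2^j≤C*[1+j]²))
          where
          m≤A*[1+j] : m ≤ A * suc j
          m≤A*[1+j] = ≤-trans (<⇒≤ m<) ([1+k+μ*j]*p≤[1+k+μ]*p*[1+j] ∣ κ ∣ μ j p)
          2^j≤C*[1+j]² : 2 ^ j ≤ C * (suc j * suc j)
          2^j≤C*[1+j]² = begin
            2 ^ j                     ≤⟨ ^-monoˡ-≤ j (nonTrivial⇒n>1 p) ⟩
            p ^ j                     ≤⟨ p^j≤∣n-a∣ ⟩
            ∣ + n ℤ.- a ∣             ≤⟨ ℤ.∣i-j∣≤∣i∣+∣j∣ (+ n) a ⟩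
            n + ∣ a ∣                 ≤⟨ +-monoˡ-≤ ∣ a ∣ (index≤ n m 1≤n x≡m!) ⟩
            2 * (m * m) + 4 + ∣ a ∣   ≡⟨ +-assoc (2 * (m * m)) 4 ∣ a ∣ ⟩
            2 * (m * m) + (4 + ∣ a ∣) ≤⟨ m≤A*[1+j]⇒2m²+D≤[2A²+D]*[1+j]² A j (4 + ∣ a ∣) m≤A*[1+j] ⟩
            C * (suc j * suc j)       ∎
            where open ≤-Reasoning

      solutions-bounded : MarquesLengyel x p → Bounded (Solutions U)
      solutions-bounded (Q , 0<Q , classes) = Bounded-⊆ residue
        (Bounded-⋃< Q (λ i → Solutions (InClass Q i)) λ i i<Q → [ solutions-C , solutions-L ] (classes i i<Q))
        where
        instance
          _ : NonZero Q
          _ = >-nonZero 0<Q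
        residue : Solutions U ⊆ (λ m → ∃[ i ] (i < Q × Solutions (InClass Q i) m))
        residue (solution n _ 1≤n x≡m!) = n % Q , m%n<n n Q , solution n (InClass-% Q n) 1≤n x≡m!

      finitely-many-solutions : MarquesLengyel x p →
        ∃[ B ] (∀ n m → 1 ≤ n → x (+ n) ≡ ℕ→ℚ (m !) → n ≤ B × m ≤ B)
      finitely-many-solutions ml with solutions-bounded ml
      ... | M , m≤M = M ⊔ (2 * (M * M) + 4) , λ n m 1≤n x≡m! →
        let m≤M′ = m≤M (solution n _ 1≤n x≡m!) in
          m≤n⇒m≤o⊔n M (≤-trans (index≤ n m 1≤n x≡m!) (+-monoˡ-≤ 4 (*-monoʳ-≤ 2 (*-mono-≤ m≤M′ m≤M′))))
        , m≤n⇒m≤n⊔o _ m≤M′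

open import Defs
open import Data.Nat using (ℕ; _<_; _≤_; _!)
open import Data.Nat.Primality using (Prime)
open import Data.Integer using (ℤ; +_; _-_)
open import Data.Rational using (ℚ; _+_; _*_; 1ℚ) renaming (_≤_ to _≤ℚ_)
open import Data.Product using (∃; ∃-syntax; _×_)
open import Relation.Binary.PropositionalEquality using (_≡_)

open import Data.Nat as ℕ using (NonZero; >-nonZero)
open import Data.Nat.Primality using (prime⇒nonTrivial)
import Data.Integer.Properties as ℤ
open import Data.Rational using (0ℚ)
import Data.Rational.Properties as ℚ
open import Data.Product using (_,_)
open import Relation.Binary.PropositionalEquality using (subst)
open Rationals using (ℤ→ℚ-cancel-≤; natural-tail; module DominantRoot)
open Recurrences using (module LinearRecurrenceGrowth)
open FactorialSolutions using (finitely-many-solutions)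

theorem1p12 : (a b c : ℕ) → 0 < a → 0 < b → 0 < c →
    (x : ℤ → ℚ) →
    (∀ (n : ℤ) → x n ≡ ℕ→ℚ a * x (n - + 1) + ℕ→ℚ b * x (n - + 2) + ℕ→ℚ c * x (n - + 3)) →
    (∃[ z ] x (+ 0) ≡ ℤ→ℚ z) → (∃[ z ] x (+ 1) ≡ ℤ→ℚ z) → (∃[ z ] x (+ 2) ≡ ℤ→ℚ z) →
    γ⁻¹[ a , b , c ]≤ x (+ 1) → x (+ 1) ≤ℚ 1ℚ → 1ℚ ≤ℚ x (+ 2) →
    x (+ 2) ≤γ[ a , b , c ] → γ[ a , b , c ]≤ x (+ 3) → x (+ 3) ≤γ²[ a , b , c ] →
    (∃[ p ] (Prime p × MarquesLengyel x p)) →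
    ∃[ B ] (∀ (n m : ℕ) → 1 ≤ n → 1 ≤ m → x (+ n) ≡ ℕ→ℚ (m !) → n ≤ B × m ≤ B)
theorem1p12 a b c 0<a 0<b 0<c x rec x₀∈ℤ x₁∈ℤ x₂∈ℤ γ⁻¹≤x₁ _ 1≤x₂ _ γ≤x₃ _ (p , p-prime , ml) =
  let u , u-rec , x≡u = natural-tail a b c {λ k → x (+ k)} (λ k → rec (+ (3 ℕ.+ k)))
                          x₀∈ℤ x₁∈ℤ x₂∈ℤ 0≤x₁ (1≤r⇒0≤r 1≤x₂) (1≤r⇒0≤r 1≤x₃)
      1≤u₂ = ℤ.drop‿+≤+ (ℤ→ℚ-cancel-≤ (subst (1ℚ ≤ℚ_) (x≡u 2) 1≤x₃))
      index≤ = LinearRecurrenceGrowth.u[k]≡m!⇒k≤2*m*m+3 a b c u-rec 1≤u₂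
      B , bounded = finitely-many-solutions x u x≡u index≤ {{prime⇒nonTrivial p-prime}} ml
  in B , λ n m 1≤n _ → bounded n m 1≤n
  where
  instance
    _ : NonZero a
    _ = >-nonZero 0<a
    _ : NonZero b
    _ = >-nonZero 0<b
    _ : NonZero c
    _ = >-nonZero 0<c
  open DominantRoot a b c
  1≤r⇒0≤r : ∀ {r} → 1ℚ ≤ℚ r → 0ℚ ≤ℚ r
  1≤r⇒0≤r = ℚ.≤-trans (ℚ.<⇒≤ (ℚ.positive⁻¹ 1ℚ))
  1≤x₃ : 1ℚ ≤ℚ x (+ 3)
  1≤x₃ = γ≤r⇒1≤r γ≤x₃
  0≤x₁ : 0ℚ ≤ℚ x (+ 1)
  0≤x₁ = ℚ.<⇒≤ (γ⁻¹≤r⇒0<r (γ≤r⇒U≢∅ γ≤x₃) γ⁻¹≤x₁)
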